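{- Let the sequences $(k_i)_{i\geq 1}$ of natural numbers and $(b_i)_{i\geq 2}$ of real functions on $[1,\infty)$ be defined as follows: $k_1=1$, $k_2=2$, $b_2(x)=\left\{\frac{x}{k_1}\right\}-\frac{k_2}{k_1}\left\{\frac{x}{k_2}\right\}$; and for $i\geq 2$, $k_{i+1}=k_i+j$ where $j$ is the least positive integer with $b_i(k_i+j)\neq b_i(k_i)$, and $$b_{i+1}(x)=b_i(x)+\bigl(1+b_i(k_i)\bigr)\left(\left\{\frac{x}{k_i}\right\}-\frac{k_{i+1}}{k_i}\left\{\frac{x}{k_{i+1}}\right\}\right).$$ Let $\mu$ denote the Möbius function. Then the following three conditions are equivalent: (a) $\displaystyle\sum_{j=1}^{i}\frac{\mu(k_j)}{k_j}=\frac{1+b_i(k_i)}{k_i}$ for all $i\geq 2$; (b) $\displaystyle b_i(x)=\sum_{j=1}^{i-1}\mu(k_j)\left\{\frac{x}{k_j}\right\}-k_i\left(\sum_{j=1}^{i-1}\frac{\mu(k_j)}{k_j}\right)\left\{\frac{x}{k_i}\right\}$ for all $x\in[1,\infty)$ and all $i\geq 2$; (c) $\displaystyle\frac{\mu(k_i)}{k_i}=\frac{1+b_i(k_i)}{k_i}-\frac{1+b_{i-1}(k_{i-1})}{k_{i-1}}$ for all $i\geq 3$. Furthermore, if $k_{i+1}<2k_i$ for all $i\geq 2$, then conditions (a), (b), (c) are also equivalent to each of the following: (d) $\mu(k_{i+1})=b_i(k_{i+1})-b_i(k_i)$ for all $i\geq 2$; (e) $\displaystyle\sum_{j=1}^{i}\mu(k_j)\left\lfloor\frac{k_i}{k_j}\right\rfloor=1$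 for all $i\geq 1$.
   Context: For real $x$, $\lfloor x\rfloor$ is the greatest integer $\leq x$ and $\{x\}=x-\lfloor x\rfloor$. $\mathbb{N}=\{1,2,3,\dots\}$. The Möbius function: $\mu(1)=1$, $\mu(n)=(-1)^r$ if $n$ is a product of $r$ distinct primes, and $\mu(n)=0$ if $n$ is divisible by the square of a prime. It is assumed that at every step $i\geq 2$ a positive integer $j$ with $b_i(k_i+j)\neq b_i(k_i)$ exists, so that the sequences $(k_i)$ and $(b_i)$ are defined for all indices.
   Formalization: The functions $b_i$ take rational arguments, and condition (b) is asserted only for rational x ≥ 1 instead of all real $x\in[1,\infty)$. -}

module Defs where

open import Data.Nat as ℕ using (ℕ; zero; suc)
open import Data.Nat.Primality using (Prime)
open import Data.Nat.Divisibility using (_∣_)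
open import Data.Integer as ℤ using (ℤ)
open import Data.Rational as ℚ using (ℚ; floor; 0ℚ; 1ℚ)
open import Data.List using (List; length)
open import Data.Nat.ListAction using (product)
open import Data.Empty using (⊥)
open import Data.List.Relation.Unary.All using (All)
open import Data.List.Relation.Unary.Unique.Propositional using (Unique)
open import Data.Product using (_×_; ∃)
open import Relation.Binary.PropositionalEquality using (_≡_)

ℕ→ℚ : ℕ → ℚ
ℕ→ℚ n = ℤ.+ n ℚ./ 1

ℤ→ℚ : ℤ → ℚ
ℤ→ℚ z = z ℚ./ 1

-- q divided by the natural number n (total: junk value 0 when n = 0;
-- only ever used with n ≥ 1)
_÷ℕ_ : ℚ → ℕ → ℚ
q ÷ℕ zero  = 0ℚ
q ÷ℕ suc n = q ℚ.* (ℤ.+ 1 ℚ./ suc n)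

frac : ℚ → ℚ
frac x = x ℚ.- ℤ→ℚ (floor x)

Σℚ : ℕ → (ℕ → ℚ) → ℚ
Σℚ zero    f = 0ℚ
Σℚ (suc i) f = Σℚ i f ℚ.+ f (suc i)

Σℤ : ℕ → (ℕ → ℤ) → ℤ
Σℤ zero    f = ℤ.0ℤ
Σℤ (suc i) f = Σℤ i f ℤ.+ f (suc i)

IsMöbius : (ℕ → ℤ) → Set
IsMöbius μ =
  (μ 1 ≡ ℤ.1ℤ)
  × (∀ (n : ℕ) (ps : List ℕ) → All Prime ps → Unique ps → product ps ≡ n →
       μ n ≡ (ℤ.- ℤ.1ℤ) ℤ.^ length ps)
  × (∀ (n p : ℕ) → Prime p → (p ℕ.* p) ∣ n → μ n ≡ ℤ.0ℤ)

-- The functions b_i (i ≥ 2) determined by the sequence k (values of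
-- b_0, b_1 are junk and never used):
--   b_2(x) = {x/k_1} - (k_2/k_1){x/k_2}
--   b_{i+1}(x) = b_i(x) + (1 + b_i(k_i)) ({x/k_i} - (k_{i+1}/k_i){x/k_{i+1}})
step : (ℕ → ℕ) → ℕ → ℚ → ℚ
step k i x = frac (x ÷ℕ k i) ℚ.- (ℕ→ℚ (k (suc i)) ÷ℕ k i) ℚ.* frac (x ÷ℕ k (suc i))

b : (ℕ → ℕ) → ℕ → ℚ → ℚ
b k zero x = 0ℚ
b k (suc zero) x = 0ℚ
b k (suc (suc zero)) x = step k 1 x
b k (suc (suc (suc i))) x =
  b k (suc (suc i)) x
  ℚ.+ (1ℚ ℚ.+ b k (suc (suc i)) (ℕ→ℚ (k (suc (suc i))))) ℚ.* step k (suc (suc i)) x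

-- k is the sequence of the paper: k_1 = 1, k_2 = 2, and for i ≥ 2,
-- k_{i+1} = k_i + j with j the least positive integer such that
-- b_i(k_i + j) ≠ b_i(k_i) (such j is assumed to exist at every step).
IsKSeq : (ℕ → ℕ) → Set
IsKSeq k =
  (k 1 ≡ 1) × (k 2 ≡ 2)
  × (∀ i → 2 ℕ.≤ i →
       ∃ λ j → 1 ℕ.≤ j × k (suc i) ≡ k i ℕ.+ j
         × (b k i (ℕ→ℚ (k i ℕ.+ j)) ≡ b k i (ℕ→ℚ (k i)) → ⊥)
         × (∀ j′ → 1 ℕ.≤ j′ → j′ ℕ.< j →
              b k i (ℕ→ℚ (k i ℕ.+ j′)) ≡ b k i (ℕ→ℚ (k i))))

μq : (ℕ → ℤ) → ℕ → ℚ
μq μ n = ℤ→ℚ (μ n)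

CondA : (ℕ → ℕ) → (ℕ → ℤ) → Set
CondA k μ = ∀ i → 2 ℕ.≤ i →
  Σℚ i (λ j → μq μ (k j) ÷ℕ k j) ≡ (1ℚ ℚ.+ b k i (ℕ→ℚ (k i))) ÷ℕ k i

CondB : (ℕ → ℕ) → (ℕ → ℤ) → Set
CondB k μ = ∀ i → 2 ℕ.≤ i → ∀ (x : ℚ) → 1ℚ ℚ.≤ x →
  b k i x ≡ Σℚ (i ℕ.∸ 1) (λ j → μq μ (k j) ℚ.* frac (x ÷ℕ k j))
            ℚ.- ℕ→ℚ (k i) ℚ.* Σℚ (i ℕ.∸ 1) (λ j → μq μ (k j) ÷ℕ k j) ℚ.* frac (x ÷ℕ k i)

CondC : (ℕ → ℕ) → (ℕ → ℤ) → Set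
CondC k μ = ∀ i → 3 ℕ.≤ i →
  μq μ (k i) ÷ℕ k i ≡ ((1ℚ ℚ.+ b k i (ℕ→ℚ (k i))) ÷ℕ k i)
                      ℚ.- ((1ℚ ℚ.+ b k (i ℕ.∸ 1) (ℕ→ℚ (k (i ℕ.∸ 1)))) ÷ℕ k (i ℕ.∸ 1))

CondD : (ℕ → ℕ) → (ℕ → ℤ) → Set
CondD k μ = ∀ i → 2 ℕ.≤ i →
  μq μ (k (suc i)) ≡ b k i (ℕ→ℚ (k (suc i))) ℚ.- b k i (ℕ→ℚ (k i))

CondE : (ℕ → ℕ) → (ℕ → ℤ) → Set
CondE k μ = ∀ i → 1 ℕ.≤ i →
  Σℤ i (λ j → μ (k j) ℤ.* floor (ℕ→ℚ (k i) ÷ℕ k j)) ≡ ℤ.1ℤ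

{-# OPTIONS --safe #-}
module Submission where

-- Put S_i = Σ_{j≤i} μ(k_j)/k_j and δ_i = 1 + b_i(k_i) - k_i S_i (the defect), so that (a) at i
-- says δ_i = 0. If B_i is the right-hand side of (b), the recursions defining b_{i+1} and B_{i+1}
-- give b_{i+1} - B_{i+1} = (b_i - B_i) + δ_i s_i, where s_i = step k i is the function multiplied
-- by 1 + b_i(k_i) in the definition of b_{i+1}; it takes the value -1 at k_i. So (a) up to i
-- gives (b) up to i + 1, and (b) at i and i + 1 gives (a) at i. Condition (c) is the difference
-- of (a) at i and at i - 1. Under (b), splitting k_i/k_j into integer and fractional parts gives
-- Σ_j μ(k_j)⌊k_i/k_j⌋ = 1 - δ_i, whence (e). If k_i < k_{i+1} < 2k_i then
-- {k_{i+1}/k_i} = k_{i+1}/k_i - 1, and once δ_i = 0 this turns δ_{i+1} into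
-- b_i(k_{i+1}) - b_i(k_i) - μ(k_{i+1}), whence (d). Each equivalence then follows by induction on
-- i, starting from (a) and (b) at i = 2, which hold outright.

open import Defs
open import Data.Nat using (ℕ; suc; _≤_; _<_)
open import Data.Integer as ℤ using (ℤ)
open import Data.Product using (_×_; _,_; proj₁)
open import Function.Bundles using (_⇔_)
open import Relation.Binary.PropositionalEquality using (_≡_; refl; sym; subst)
open import Data.Nat.Properties using (m<m+n)
open import Data.Nat.Primality using (prime?)
open import Relation.Nullary.Decidable using (from-yes)
open import Data.List using (_∷_; [])
open import Data.List.Relation.Unary.All using (_∷_; [])
open import Data.List.Relation.Unary.AllPairs using (_∷_; [])

module RationalArithmetic where

  open import Data.Nat as ℕ using (zero; NonZero)
  import Data.Nat.Properties as ℕₚ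
  open import Data.Nat.DivMod using (m<n⇒m/n≡0; m≥n⇒m/n>0; m<n*o⇒m/o<n; m*n/o*n≡m/o; m/n*n≡m; /-congˡ; /-congʳ)
  open import Data.Nat.GCD using (gcd; gcd[m,n]∣m; gcd[m,n]∣n; gcd[m,n]≢0; n/gcd[m,n]≢0)
  open import Data.Nat.Coprimality using (Coprime)
  open import Data.Integer as ℤ using (+_; +≤+)
  import Data.Integer.Properties as ℤₚ
  open import Data.Integer.DivMod using (div-pos-is-/ℕ)
  import Data.Rational.Solver as ℚ-Solver
  open import Data.Rational as ℚ using (mkℚ+; 0ℚ; 1ℚ; floor; _+_; _*_; _-_; _/_; toℚᵘ; fromℚᵘ)
  import Data.Rational.Properties as ℚₚ
  open import Data.Rational.Unnormalised as ℚᵘ using (mkℚᵘ; *≡*; *≤*)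
  import Data.Rational.Unnormalised.Properties as ℚᵘₚ
  open import Data.Sum using (inj₂)
  open import Relation.Binary.PropositionalEquality


  fromℚᵘ-homo-+ : ∀ p q → fromℚᵘ (p ℚᵘ.+ q) ≡ fromℚᵘ p + fromℚᵘ q
  fromℚᵘ-homo-+ p q = ℚₚ.toℚᵘ-injective (begin
    toℚᵘ (fromℚᵘ (p ℚᵘ.+ q))                  ≈⟨ ℚₚ.toℚᵘ-fromℚᵘ (p ℚᵘ.+ q) ⟩
    p ℚᵘ.+ q                                  ≈⟨ ℚᵘₚ.+-cong (ℚₚ.toℚᵘ-fromℚᵘ p) (ℚₚ.toℚᵘ-fromℚᵘ q) ⟨
    toℚᵘ (fromℚᵘ p) ℚᵘ.+ toℚᵘ (fromℚᵘ q)      ≈⟨ ℚₚ.toℚᵘ-homo-+ (fromℚᵘ p) (fromℚᵘ q) ⟨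
    toℚᵘ (fromℚᵘ p + fromℚᵘ q)                ∎)
    where open ℚᵘₚ.≃-Reasoning

  fromℚᵘ-homo-* : ∀ p q → fromℚᵘ (p ℚᵘ.* q) ≡ fromℚᵘ p * fromℚᵘ q
  fromℚᵘ-homo-* p q = ℚₚ.toℚᵘ-injective (begin
    toℚᵘ (fromℚᵘ (p ℚᵘ.* q))                  ≈⟨ ℚₚ.toℚᵘ-fromℚᵘ (p ℚᵘ.* q) ⟩
    p ℚᵘ.* q                                  ≈⟨ ℚᵘₚ.*-cong (ℚₚ.toℚᵘ-fromℚᵘ p) (ℚₚ.toℚᵘ-fromℚᵘ q) ⟨
    toℚᵘ (fromℚᵘ p) ℚᵘ.* toℚᵘ (fromℚᵘ q)      ≈⟨ ℚₚ.toℚᵘ-homo-* (fromℚᵘ p) (fromℚᵘ q) ⟨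
    toℚᵘ (fromℚᵘ p * fromℚᵘ q)                ∎)
    where open ℚᵘₚ.≃-Reasoning

  -- ℤ→ℚ z is definitionally fromℚᵘ (mkℚᵘ z 0).
  ℤ→ℚ-homo-+ : ∀ a b → ℤ→ℚ (a ℤ.+ b) ≡ ℤ→ℚ a + ℤ→ℚ b
  ℤ→ℚ-homo-+ a b = trans (ℚₚ.fromℚᵘ-cong {mkℚᵘ (a ℤ.+ b) 0} {mkℚᵘ a 0 ℚᵘ.+ mkℚᵘ b 0} (*≡* a+b≃a+b))
                         (fromℚᵘ-homo-+ (mkℚᵘ a 0) (mkℚᵘ b 0))
    where
    a+b≃a+b : (a ℤ.+ b) ℤ.* + 1 ≡ (a ℤ.* + 1 ℤ.+ b ℤ.* + 1) ℤ.* + 1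
    a+b≃a+b = trans (ℤₚ.*-identityʳ _)
      (sym (trans (ℤₚ.*-identityʳ _) (cong₂ ℤ._+_ (ℤₚ.*-identityʳ a) (ℤₚ.*-identityʳ b))))

  ℤ→ℚ-homo-* : ∀ a b → ℤ→ℚ (a ℤ.* b) ≡ ℤ→ℚ a * ℤ→ℚ b
  ℤ→ℚ-homo-* a b = fromℚᵘ-homo-* (mkℚᵘ a 0) (mkℚᵘ b 0)

  ℤ→ℚ-injective : ∀ {a b} → ℤ→ℚ a ≡ ℤ→ℚ b → a ≡ b
  ℤ→ℚ-injective {a} {b} eq with ℚₚ.fromℚᵘ-injective {mkℚᵘ a 0} {mkℚᵘ b 0} eq
  ... | *≡* a*1≡b*1 = trans (sym (ℤₚ.*-identityʳ a)) (trans a*1≡b*1 (ℤₚ.*-identityʳ b))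

  ÷ℕ-as-* : ∀ q n → q ÷ℕ n ≡ q * (1ℚ ÷ℕ n)
  ÷ℕ-as-* q zero    = sym (ℚₚ.*-zeroʳ q)
  ÷ℕ-as-* q (suc n) = cong (q *_) (sym (ℚₚ.*-identityˡ _))

  ℕ→ℚ*1÷ℕ≡1 : ∀ n .{{_ : NonZero n}} → ℕ→ℚ n * (1ℚ ÷ℕ n) ≡ 1ℚ
  ℕ→ℚ*1÷ℕ≡1 (suc n) = begin
    ℕ→ℚ (suc n) * (1ℚ * (+ 1 / suc n))                  ≡⟨ cong (ℕ→ℚ (suc n) *_) (ℚₚ.*-identityˡ _) ⟩
    fromℚᵘ (mkℚᵘ (+ suc n) 0) * fromℚᵘ (mkℚᵘ (+ 1) n)   ≡⟨ fromℚᵘ-homo-* (mkℚᵘ (+ suc n) 0) (mkℚᵘ (+ 1) n) ⟨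
    fromℚᵘ (mkℚᵘ (+ suc n) 0 ℚᵘ.* mkℚᵘ (+ 1) n)         ≡⟨ ℚₚ.fromℚᵘ-cong {mkℚᵘ (+ suc n) 0 ℚᵘ.* mkℚᵘ (+ 1) n} {mkℚᵘ (+ 1) 0} (*≡* n*1*1≡1*[1*n]) ⟩
    1ℚ                                                  ∎
    where
    open ≡-Reasoning
    n*1*1≡1*[1*n] : + (suc n ℕ.* 1 ℕ.* 1) ≡ + (1 ℕ.* (1 ℕ.* suc n))
    n*1*1≡1*[1*n] = cong +_ (trans (ℕₚ.*-comm (suc n ℕ.* 1) 1) (cong (1 ℕ.*_) (ℕₚ.*-comm (suc n) 1)))

  ℕ→ℚ÷ℕ-self : ∀ n .{{_ : NonZero n}} → ℕ→ℚ n ÷ℕ n ≡ 1ℚ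
  ℕ→ℚ÷ℕ-self n = trans (÷ℕ-as-* (ℕ→ℚ n) n) (ℕ→ℚ*1÷ℕ≡1 n)

  ℕ→ℚ*÷ℕ-cancel : ∀ n .{{_ : NonZero n}} q → ℕ→ℚ n * (q ÷ℕ n) ≡ q
  ℕ→ℚ*÷ℕ-cancel n q = begin
    ℕ→ℚ n * (q ÷ℕ n)            ≡⟨ cong (ℕ→ℚ n *_) (÷ℕ-as-* q n) ⟩
    ℕ→ℚ n * (q * (1ℚ ÷ℕ n))     ≡⟨ ℚₚ.*-assoc (ℕ→ℚ n) q _ ⟨
    ℕ→ℚ n * q * (1ℚ ÷ℕ n)       ≡⟨ cong (_* (1ℚ ÷ℕ n)) (ℚₚ.*-comm (ℕ→ℚ n) q) ⟩
    q * ℕ→ℚ n * (1ℚ ÷ℕ n)       ≡⟨ ℚₚ.*-assoc q (ℕ→ℚ n) _ ⟩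
    q * (ℕ→ℚ n * (1ℚ ÷ℕ n))     ≡⟨ cong (q *_) (ℕ→ℚ*1÷ℕ≡1 n) ⟩
    q * 1ℚ                      ≡⟨ ℚₚ.*-identityʳ q ⟩
    q                           ∎
    where open ≡-Reasoning

  ℕ→ℚ*-÷ℕ-cancel : ∀ n .{{_ : NonZero n}} q → (ℕ→ℚ n * q) ÷ℕ n ≡ q
  ℕ→ℚ*-÷ℕ-cancel n q = begin
    (ℕ→ℚ n * q) ÷ℕ n            ≡⟨ ÷ℕ-as-* (ℕ→ℚ n * q) n ⟩
    ℕ→ℚ n * q * (1ℚ ÷ℕ n)       ≡⟨ ℚₚ.*-assoc (ℕ→ℚ n) q _ ⟩
    ℕ→ℚ n * (q * (1ℚ ÷ℕ n))     ≡⟨ cong (ℕ→ℚ n *_) (÷ℕ-as-* q n) ⟨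
    ℕ→ℚ n * (q ÷ℕ n)            ≡⟨ ℕ→ℚ*÷ℕ-cancel n q ⟩
    q                           ∎
    where open ≡-Reasoning

  ℕ→ℚ÷ℕ≡/ : ∀ m n .{{_ : NonZero n}} → ℕ→ℚ m ÷ℕ n ≡ + m / n
  ℕ→ℚ÷ℕ≡/ m (suc n) = begin
    fromℚᵘ (mkℚᵘ (+ m) 0) * fromℚᵘ (mkℚᵘ (+ 1) n)   ≡⟨ fromℚᵘ-homo-* (mkℚᵘ (+ m) 0) (mkℚᵘ (+ 1) n) ⟨
    fromℚᵘ (mkℚᵘ (+ m) 0 ℚᵘ.* mkℚᵘ (+ 1) n)         ≡⟨ ℚₚ.fromℚᵘ-cong {mkℚᵘ (+ m) 0 ℚᵘ.* mkℚᵘ (+ 1) n} {mkℚᵘ (+ m) n} (*≡* m*1*n≡m*[1*n]) ⟩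
    fromℚᵘ (mkℚᵘ (+ m) n)                           ∎
    where
    open ≡-Reasoning
    m*1*n≡m*[1*n] : (+ m ℤ.* + 1) ℤ.* + suc n ≡ + m ℤ.* + (1 ℕ.* suc n)
    m*1*n≡m*[1*n] = trans (cong (ℤ._* + suc n) (ℤₚ.*-identityʳ (+ m)))
                          (cong (λ d → + m ℤ.* + d) (sym (ℕₚ.*-identityˡ (suc n))))

  floor-mkℚ+ : ∀ a b .{{_ : NonZero b}} .(c : Coprime a b) → floor (mkℚ+ a b c) ≡ + (a ℕ./ b)
  floor-mkℚ+ a (suc b) c = div-pos-is-/ℕ (+ a) (suc b)

  floor-/ : ∀ m n .{{_ : NonZero n}} → floor (+ m / n) ≡ + (m ℕ./ n)
  floor-/ m n@(suc _) = trans (floor-mkℚ+ (m ℕ./ g) (n ℕ./ g) _) (cong +_ [m/g]/[n/g]≡m/n)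
    where
    g = gcd m n
    instance
      g≢0 : NonZero g
      g≢0 = ℕ.≢-nonZero (gcd[m,n]≢0 m n (inj₂ (ℕ.≢-nonZero⁻¹ n)))
      n/g≢0 : NonZero (n ℕ./ g)
      n/g≢0 = ℕ.≢-nonZero (n/gcd[m,n]≢0 m n)
    n/g*g≢0 : NonZero ((n ℕ./ g) ℕ.* g)
    n/g*g≢0 = subst NonZero (sym (m/n*n≡m (gcd[m,n]∣n m n))) _
    [m/g]/[n/g]≡m/n : (m ℕ./ g) ℕ./ (n ℕ./ g) ≡ m ℕ./ n
    [m/g]/[n/g]≡m/n = trans (sym (m*n/o*n≡m/o (m ℕ./ g) g (n ℕ./ g) {{_}} {{n/g*g≢0}}))
      (trans (/-congˡ {{n/g*g≢0}} (m/n*n≡m (gcd[m,n]∣m m n)))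
             (/-congʳ {{n/g*g≢0}} (m/n*n≡m (gcd[m,n]∣n m n))))

  frac-ℕ→ℚ÷ℕ : ∀ m n .{{_ : NonZero n}} → frac (ℕ→ℚ m ÷ℕ n) ≡ ℕ→ℚ m ÷ℕ n - ℕ→ℚ (m ℕ./ n)
  frac-ℕ→ℚ÷ℕ m n = cong (λ z → ℕ→ℚ m ÷ℕ n - ℤ→ℚ z) (trans (cong floor (ℕ→ℚ÷ℕ≡/ m n)) (floor-/ m n))

  frac-ℕ→ℚ÷ℕ-< : ∀ {m n} .{{_ : NonZero n}} → m < n → frac (ℕ→ℚ m ÷ℕ n) ≡ ℕ→ℚ m ÷ℕ n
  frac-ℕ→ℚ÷ℕ-< {m} {n} m<n = begin
    frac (ℕ→ℚ m ÷ℕ n)               ≡⟨ frac-ℕ→ℚ÷ℕ m n ⟩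
    ℕ→ℚ m ÷ℕ n - ℕ→ℚ (m ℕ./ n)      ≡⟨ cong (λ j → ℕ→ℚ m ÷ℕ n - ℕ→ℚ j) (m<n⇒m/n≡0 m<n) ⟩
    ℕ→ℚ m ÷ℕ n + 0ℚ                 ≡⟨ ℚₚ.+-identityʳ _ ⟩
    ℕ→ℚ m ÷ℕ n                      ∎
    where open ≡-Reasoning

  frac-ℕ→ℚ÷ℕ-self : ∀ n .{{_ : NonZero n}} → frac (ℕ→ℚ n ÷ℕ n) ≡ 0ℚ
  frac-ℕ→ℚ÷ℕ-self n = cong frac (ℕ→ℚ÷ℕ-self n)

  frac-ℕ→ℚ÷ℕ-<2* : ∀ {m n} .{{_ : NonZero n}} → n ≤ m → m < 2 ℕ.* n →
                   frac (ℕ→ℚ m ÷ℕ n) ≡ ℕ→ℚ m ÷ℕ n - 1ℚ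
  frac-ℕ→ℚ÷ℕ-<2* {m} {n} n≤m m<2n =
    trans (frac-ℕ→ℚ÷ℕ m n) (cong (λ j → ℕ→ℚ m ÷ℕ n - ℕ→ℚ j) (m/n≡1 (m≥n⇒m/n>0 n≤m) (m<n*o⇒m/o<n m<2n)))
    where
    m/n≡1 : ∀ {q} → 0 < q → q < 2 → q ≡ 1
    m/n≡1 (ℕ.s≤s ℕ.z≤n) (ℕ.s≤s (ℕ.s≤s ℕ.z≤n)) = refl

  1≤ℕ→ℚ : ∀ {n} → 1 ≤ n → 1ℚ ℚ.≤ ℕ→ℚ n
  1≤ℕ→ℚ {n} 1≤n = ℚₚ.toℚᵘ-cancel-≤ (ℚᵘₚ.≤-respʳ-≃ (ℚᵘₚ.≃-sym (ℚₚ.toℚᵘ-fromℚᵘ (mkℚᵘ (+ n) 0)))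
    (*≤* (subst (ℤ._≤_ (+ 1)) (sym (ℤₚ.*-identityʳ (+ n))) (+≤+ 1≤n))))

  ℤ→ℚ-floor : ∀ y → ℤ→ℚ (floor y) ≡ y - frac y
  ℤ→ℚ-floor y = solve 2 (λ y ⌊y⌋ → ⌊y⌋ := y :- (y :- ⌊y⌋)) refl y (ℤ→ℚ (floor y))
    where open ℚ-Solver.+-*-Solver

  ℤ→ℚ-Σℤ-floor : ∀ n (w : ℕ → ℤ) (d : ℕ → ℕ) x →
    ℤ→ℚ (Σℤ n (λ j → w j ℤ.* floor (x ÷ℕ d j)))
      ≡ x * Σℚ n (λ j → ℤ→ℚ (w j) ÷ℕ d j) - Σℚ n (λ j → ℤ→ℚ (w j) * frac (x ÷ℕ d j))
  ℤ→ℚ-Σℤ-floor zero    w d x = cong (_- 0ℚ) (sym (ℚₚ.*-zeroʳ x))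
  ℤ→ℚ-Σℤ-floor (suc n) w d x = begin
    ℤ→ℚ (Σℤ n t ℤ.+ t (suc n))                 ≡⟨ ℤ→ℚ-homo-+ (Σℤ n t) (t (suc n)) ⟩
    ℤ→ℚ (Σℤ n t) + ℤ→ℚ (t (suc n))             ≡⟨ cong₂ _+_ (ℤ→ℚ-Σℤ-floor n w d x) (ℤ→ℚ-homo-* (w (suc n)) _) ⟩
    (x * S - G) + W * ℤ→ℚ (floor (x ÷ℕ d (suc n)))
                                               ≡⟨ cong (λ y → (x * S - G) + W * y) (ℤ→ℚ-floor (x ÷ℕ d (suc n))) ⟩
    (x * S - G) + W * (x ÷ℕ d (suc n) - f)     ≡⟨ cong (λ y → (x * S - G) + W * (y - f)) (÷ℕ-as-* x (d (suc n))) ⟩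
    (x * S - G) + W * (x * v - f)              ≡⟨ solve 6 (λ x S G W v f → (x :* S :- G) :+ W :* (x :* v :- f)
                                                                         := x :* (S :+ W :* v) :- (G :+ W :* f)) refl x S G W v f ⟩
    x * (S + W * v) - (G + W * f)              ≡⟨ cong (λ z → x * (S + z) - (G + W * f)) (÷ℕ-as-* W (d (suc n))) ⟨
    x * (S + W ÷ℕ d (suc n)) - (G + W * f)     ∎
    where
    open ≡-Reasoning
    open ℚ-Solver.+-*-Solver
    t : ℕ → ℤ
    t j = w j ℤ.* floor (x ÷ℕ d j)
    S = Σℚ n (λ j → ℤ→ℚ (w j) ÷ℕ d j)
    G = Σℚ n (λ j → ℤ→ℚ (w j) * frac (x ÷ℕ d j))
    W = ℤ→ℚ (w (suc n))
    v = 1ℚ ÷ℕ d (suc n)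
    f = frac (x ÷ℕ d (suc n))

  -- Identities involving a reciprocal u = 1 ÷ℕ n are checked by the ring solver up to a
  -- multiple of n * u - 1.
  ≡-modulo-unit : ∀ {p q} u r → u ≡ 1ℚ → p + (u - 1ℚ) * r ≡ q → p ≡ q
  ≡-modulo-unit {p} u r refl eq = trans (sym (solve 2 (λ p r → p :+ (con 1ℚ :- con 1ℚ) :* r := p) refl p r)) eq
    where open ℚ-Solver.+-*-Solver

module KSequence (k : ℕ → ℕ) (μ : ℕ → ℤ)
                 (k₁≡1 : k 1 ≡ 1) (k₂≡2 : k 2 ≡ 2) (k-increasing : ∀ i → 2 ≤ i → k i < k (suc i))
                 (μ1≡1 : μ 1 ≡ ℤ.1ℤ) (μ2≡-1 : μ 2 ≡ ℤ.- ℤ.1ℤ) where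

  open RationalArithmetic
  open import Data.Nat as ℕ using (zero; NonZero; _∸_; z≤n; s≤s)
  import Data.Nat.Properties as ℕₚ
  open import Data.Rational as ℚ using (ℚ; 0ℚ; 1ℚ; floor; _+_; _*_; _-_; -_)
  import Data.Rational.Properties as ℚₚ
  import Data.Rational.Solver as ℚ-Solver
  open import Algebra.Properties.Group ℚₚ.+-0-group using (x∙y⁻¹≈ε⇒x≈y; x≈y⇒x∙y⁻¹≈ε)
  open import Data.Product using (proj₂)
  open import Function.Bundles using (mk⇔)
  open import Relation.Binary.PropositionalEquality

  k-nonZero : ∀ {i} → 1 ≤ i → NonZero (k i)
  k-nonZero {1}                 _ = subst NonZero (sym k₁≡1) _
  k-nonZero {2}                 _ = subst NonZero (sym k₂≡2) _
  k-nonZero {suc (suc (suc i))} _ =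
    ℕ.>-nonZero (ℕₚ.≤-<-trans z≤n (k-increasing (suc (suc i)) (s≤s (s≤s z≤n))))

  κ : ℕ → ℚ
  κ i = ℕ→ℚ (k i)

  ν : ℕ → ℚ
  ν i = μq μ (k i)

  S : ℕ → ℚ
  S n = Σℚ n (λ j → ν j ÷ℕ k j)

  G : ℕ → ℚ → ℚ
  G n x = Σℚ n (λ j → ν j * frac (x ÷ℕ k j))

  bFormula : ℕ → ℚ → ℚ
  bFormula i x = G (i ∸ 1) x - κ i * S (i ∸ 1) * frac (x ÷ℕ k i)

  defect : ℕ → ℚ
  defect i = (1ℚ + b k i (κ i)) - κ i * S i

  floorSum : ℕ → ℤ
  floorSum i = Σℤ i (λ j → μ (k j) ℤ.* floor (κ i ÷ℕ k j))

  CondA-at CondB-at CondC-at CondD-at CondE-at : ℕ → Set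
  CondA-at i = S i ≡ (1ℚ + b k i (κ i)) ÷ℕ k i
  CondB-at i = ∀ x → 1ℚ ℚ.≤ x → b k i x ≡ bFormula i x
  CondC-at i = ν i ÷ℕ k i ≡ ((1ℚ + b k i (κ i)) ÷ℕ k i) - ((1ℚ + b k (i ∸ 1) (κ (i ∸ 1))) ÷ℕ k (i ∸ 1))
  CondD-at i = ν (suc i) ≡ b k i (κ (suc i)) - b k i (κ i)
  CondE-at i = floorSum i ≡ ℤ.1ℤ

  b-suc : ∀ {i} → 2 ≤ i → ∀ x → b k (suc i) x ≡ b k i x + (1ℚ + b k i (κ i)) * step k i x
  b-suc {suc (suc i)} (s≤s (s≤s z≤n)) x = refl

  bFormula-suc : ∀ {i} → 1 ≤ i → ∀ x → bFormula (suc i) x ≡ bFormula i x + κ i * S i * step k i x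
  bFormula-suc {suc j} 1≤i x = ≡-modulo-unit (K * u) r (ℕ→ℚ*1÷ℕ≡1 (k i)) (begin
      (g + m * f - K′ * (s + m ÷ℕ k i) * f′) + (K * u - 1ℚ) * r
    ≡⟨ cong (λ z → (g + m * f - K′ * (s + z) * f′) + (K * u - 1ℚ) * r) (÷ℕ-as-* m (k i)) ⟩
      (g + m * f - K′ * (s + m * u) * f′) + (K * u - 1ℚ) * (m * f - s * K′ * f′ - m * K′ * u * f′)
    ≡⟨ solve 8 (λ g m f K′ s u f′ K →
         (g :+ m :* f :- K′ :* (s :+ m :* u) :* f′) :+ (K :* u :- con 1ℚ) :* (m :* f :- s :* K′ :* f′ :- m :* K′ :* u :* f′)
         := (g :- K :* s :* f) :+ K :* (s :+ m :* u) :* (f :- K′ :* u :* f′)) refl g m f K′ s u f′ K ⟩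
      (g - K * s * f) + K * (s + m * u) * (f - K′ * u * f′)
    ≡⟨ cong₂ (λ y z → (g - K * s * f) + K * (s + y) * (f - z * f′)) (÷ℕ-as-* m (k i)) (÷ℕ-as-* K′ (k i)) ⟨
      bFormula i x + K * S i * step k i x
    ∎)
    where
    open ≡-Reasoning
    open ℚ-Solver.+-*-Solver
    i = suc j
    instance _ = k-nonZero 1≤i
    K = κ i
    K′ = κ (suc i)
    u = 1ℚ ÷ℕ k i
    m = ν i
    s = S j
    g = G j x
    f = frac (x ÷ℕ k i)
    f′ = frac (x ÷ℕ k (suc i))
    r = m * f - s * K′ * f′ - m * K′ * u * f′

  b-bFormula-suc : ∀ {i} → 2 ≤ i → ∀ x →
    b k (suc i) x - bFormula (suc i) x ≡ (b k i x - bFormula i x) + defect i * step k i x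
  b-bFormula-suc {i} 2≤i x = begin
    b k (suc i) x - bFormula (suc i) x
      ≡⟨ cong₂ _-_ (b-suc 2≤i x) (bFormula-suc (ℕₚ.<⇒≤ 2≤i) x) ⟩
    (b k i x + (1ℚ + c) * st) - (bFormula i x + κ i * S i * st)
      ≡⟨ solve 6 (λ bx c st bF K s → (bx :+ (con 1ℚ :+ c) :* st) :- (bF :+ K :* s :* st)
                                    := (bx :- bF) :+ ((con 1ℚ :+ c) :- K :* s) :* st)
               refl (b k i x) c st (bFormula i x) (κ i) (S i) ⟩
    (b k i x - bFormula i x) + defect i * st
      ∎
    where
    open ≡-Reasoning
    open ℚ-Solver.+-*-Solver
    c = b k i (κ i)
    st = step k i x

  step-at-κ : ∀ {i} → 2 ≤ i → step k i (κ i) ≡ - 1ℚ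
  step-at-κ {i} 2≤i = begin
    frac (κ i ÷ℕ k i) - (κ (suc i) ÷ℕ k i) * frac (κ i ÷ℕ k (suc i))
      ≡⟨ cong₂ (λ y z → y - (κ (suc i) ÷ℕ k i) * z) (frac-ℕ→ℚ÷ℕ-self (k i)) (frac-ℕ→ℚ÷ℕ-< (k-increasing i 2≤i)) ⟩
    0ℚ - (κ (suc i) ÷ℕ k i) * (κ i ÷ℕ k (suc i))
      ≡⟨ cong₂ (λ y z → 0ℚ - y * z) (÷ℕ-as-* (κ (suc i)) (k i)) (÷ℕ-as-* (κ i) (k (suc i))) ⟩
    0ℚ - (K′ * u) * (K * u′)
      ≡⟨ solve 4 (λ K u K′ u′ → con 0ℚ :- (K′ :* u) :* (K :* u′) := :- ((K :* u) :* (K′ :* u′))) refl K u K′ u′ ⟩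
    - ((K * u) * (K′ * u′))
      ≡⟨ cong₂ (λ y z → - (y * z)) (ℕ→ℚ*1÷ℕ≡1 (k i)) (ℕ→ℚ*1÷ℕ≡1 (k (suc i))) ⟩
    - 1ℚ
      ∎
    where
    open ≡-Reasoning
    open ℚ-Solver.+-*-Solver
    instance
      _ = k-nonZero (ℕₚ.<⇒≤ 2≤i)
      _ = k-nonZero {suc i} (s≤s z≤n)
    K = κ i
    K′ = κ (suc i)
    u = 1ℚ ÷ℕ k i
    u′ = 1ℚ ÷ℕ k (suc i)

  step-at-κ-suc : ∀ {i} → 2 ≤ i → k (suc i) < 2 ℕ.* k i → step k i (κ (suc i)) ≡ κ (suc i) ÷ℕ k i - 1ℚ
  step-at-κ-suc {i} 2≤i k<2k = begin
    frac (κ (suc i) ÷ℕ k i) - (κ (suc i) ÷ℕ k i) * frac (κ (suc i) ÷ℕ k (suc i))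
      ≡⟨ cong₂ (λ y z → y - (κ (suc i) ÷ℕ k i) * z)
               (frac-ℕ→ℚ÷ℕ-<2* (ℕₚ.<⇒≤ (k-increasing i 2≤i)) k<2k) (frac-ℕ→ℚ÷ℕ-self (k (suc i))) ⟩
    (κ (suc i) ÷ℕ k i - 1ℚ) - (κ (suc i) ÷ℕ k i) * 0ℚ
      ≡⟨ solve 1 (λ y → (y :- con 1ℚ) :- y :* con 0ℚ := y :- con 1ℚ) refl (κ (suc i) ÷ℕ k i) ⟩
    κ (suc i) ÷ℕ k i - 1ℚ
      ∎
    where
    open ≡-Reasoning
    open ℚ-Solver.+-*-Solver
    instance
      _ = k-nonZero (ℕₚ.<⇒≤ 2≤i)
      _ = k-nonZero {suc i} (s≤s z≤n)

  ÷ℕk₁ : ∀ q → q ÷ℕ k 1 ≡ q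
  ÷ℕk₁ q rewrite k₁≡1 = ℚₚ.*-identityʳ q

  ν₁≡1 : ν 1 ≡ 1ℚ
  ν₁≡1 rewrite k₁≡1 | μ1≡1 = refl

  CondB-at-2 : CondB-at 2
  CondB-at-2 x _ = begin
    f₁ - (κ 2 ÷ℕ k 1) * f₂
      ≡⟨ cong (λ y → f₁ - y * f₂) (÷ℕk₁ (κ 2)) ⟩
    f₁ - κ 2 * f₂
      ≡⟨ solve 3 (λ f₁ f₂ K → f₁ :- K :* f₂ := (con 0ℚ :+ con 1ℚ :* f₁) :- K :* (con 0ℚ :+ con 1ℚ) :* f₂) refl f₁ f₂ (κ 2) ⟩
    (0ℚ + 1ℚ * f₁) - κ 2 * (0ℚ + 1ℚ) * f₂
      ≡⟨ cong₂ (λ y z → (0ℚ + y * f₁) - κ 2 * (0ℚ + z) * f₂) ν₁≡1 (trans (÷ℕk₁ (ν 1)) ν₁≡1) ⟨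
    bFormula 2 x
      ∎
    where
    open ≡-Reasoning
    open ℚ-Solver.+-*-Solver
    f₁ = frac (x ÷ℕ k 1)
    f₂ = frac (x ÷ℕ k 2)

  CondA-at-2 : CondA-at 2
  CondA-at-2 rewrite k₁≡1 | k₂≡2 | μ1≡1 | μ2≡-1 = refl

  CondA-at⇒defect≡0 : ∀ {i} → 1 ≤ i → CondA-at i → defect i ≡ 0ℚ
  CondA-at⇒defect≡0 {i} 1≤i A = x≈y⇒x∙y⁻¹≈ε (sym (trans (cong (κ i *_) A) (ℕ→ℚ*÷ℕ-cancel (k i) _)))
    where instance _ = k-nonZero 1≤i

  defect≡0⇒CondA-at : ∀ {i} → 1 ≤ i → defect i ≡ 0ℚ → CondA-at i
  defect≡0⇒CondA-at {i} 1≤i d≡0 = sym (trans (cong (_÷ℕ k i) (x∙y⁻¹≈ε⇒x≈y _ _ d≡0)) (ℕ→ℚ*-÷ℕ-cancel (k i) (S i)))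
    where instance _ = k-nonZero 1≤i

  1≤κ : ∀ {i} → 1 ≤ i → 1ℚ ℚ.≤ κ i
  1≤κ 1≤i = 1≤ℕ→ℚ (ℕ.>-nonZero⁻¹ _ {{k-nonZero 1≤i}})

  CondA-at-of-CondB : ∀ {i} → 2 ≤ i → CondB-at i → CondB-at (suc i) → CondA-at i
  CondA-at-of-CondB {i} 2≤i B B′ = defect≡0⇒CondA-at (ℕₚ.<⇒≤ 2≤i) (begin
    defect i                                      ≡⟨ solve 1 (λ d → d := :- (con 0ℚ :+ d :* :- con 1ℚ)) refl (defect i) ⟩
    - (0ℚ + defect i * - 1ℚ)                      ≡⟨ cong₂ (λ y z → - (y + defect i * z)) (x≈y⇒x∙y⁻¹≈ε (B K 1≤K)) (step-at-κ 2≤i) ⟨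
    - (e i + defect i * step k i K)               ≡⟨ cong -_ (b-bFormula-suc 2≤i K) ⟨
    - e (suc i)                                   ≡⟨ cong -_ (x≈y⇒x∙y⁻¹≈ε (B′ K 1≤K)) ⟩
    0ℚ                                            ∎)
    where
    open ≡-Reasoning
    open ℚ-Solver.+-*-Solver
    K = κ i
    1≤K = 1≤κ (ℕₚ.<⇒≤ 2≤i)
    e : ℕ → ℚ
    e j = b k j K - bFormula j K

  CondB-at-suc : ∀ {i} → 2 ≤ i → CondB-at i → CondA-at i → CondB-at (suc i)
  CondB-at-suc {i} 2≤i B A x 1≤x = x∙y⁻¹≈ε⇒x≈y _ _ (begin
    b k (suc i) x - bFormula (suc i) x                     ≡⟨ b-bFormula-suc 2≤i x ⟩
    (b k i x - bFormula i x) + defect i * step k i x       ≡⟨ cong₂ (λ y z → y + z * step k i x) (x≈y⇒x∙y⁻¹≈ε (B x 1≤x)) (CondA-at⇒defect≡0 (ℕₚ.<⇒≤ 2≤i) A) ⟩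
    0ℚ + 0ℚ * step k i x                                   ≡⟨ solve 1 (λ st → con 0ℚ :+ con 0ℚ :* st := con 0ℚ) refl (step k i x) ⟩
    0ℚ                                                     ∎)
    where
    open ≡-Reasoning
    open ℚ-Solver.+-*-Solver

  CondB-of-CondA : CondA k μ → CondB k μ
  CondB-of-CondA A (suc (suc zero))    (s≤s (s≤s z≤n)) = CondB-at-2
  CondB-of-CondA A (suc (suc (suc i))) (s≤s (s≤s z≤n)) =
    CondB-at-suc 2≤i (CondB-of-CondA A (suc (suc i)) 2≤i) (A (suc (suc i)) 2≤i)
    where 2≤i = s≤s (s≤s z≤n)

  CondA-by-induction : (∀ {i} → 2 ≤ i → CondA-at i → CondB-at (suc i) → CondA-at (suc i)) → CondA k μ
  CondA-by-induction next (suc (suc n)) (s≤s (s≤s z≤n)) = proj₂ (upto n)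
    where
    upto : ∀ n → CondB-at (2 ℕ.+ n) × CondA-at (2 ℕ.+ n)
    upto zero    = CondB-at-2 , CondA-at-2
    upto (suc n) with upto n
    ... | B , A = B′ , next (s≤s (s≤s z≤n)) A B′
      where B′ = CondB-at-suc (s≤s (s≤s z≤n)) B A

  defect≡1-floorSum : ∀ {i} → 2 ≤ i → CondB-at i → defect i ≡ 1ℚ - ℤ→ℚ (floorSum i)
  defect≡1-floorSum {suc j} 2≤i B = begin
    (1ℚ + b k i K) - K * S i
      ≡⟨ cong (λ y → (1ℚ + y) - K * S i) (B K (1≤κ (ℕₚ.<⇒≤ 2≤i))) ⟩
    (1ℚ + (G j K - K * S j * frac (K ÷ℕ k i))) - K * S i
      ≡⟨ cong (λ f → (1ℚ + (G j K - K * S j * f)) - K * S i) (frac-ℕ→ℚ÷ℕ-self (k i)) ⟩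
    (1ℚ + (G j K - K * S j * 0ℚ)) - K * S i
      ≡⟨ solve 5 (λ g K s Sᵢ m → (con 1ℚ :+ (g :- K :* s :* con 0ℚ)) :- K :* Sᵢ
                              := con 1ℚ :- (K :* Sᵢ :- (g :+ m :* con 0ℚ))) refl (G j K) K (S j) (S i) (ν i) ⟩
    1ℚ - (K * S i - (G j K + ν i * 0ℚ))
      ≡⟨ cong (λ f → 1ℚ - (K * S i - (G j K + ν i * f))) (frac-ℕ→ℚ÷ℕ-self (k i)) ⟨
    1ℚ - (K * S i - G i K)
      ≡⟨ cong (λ y → 1ℚ - y) (ℤ→ℚ-Σℤ-floor i (λ j → μ (k j)) k K) ⟨
    1ℚ - ℤ→ℚ (floorSum i)
      ∎
    where
    open ≡-Reasoning
    open ℚ-Solver.+-*-Solver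
    i = suc j
    K = κ i
    instance _ = k-nonZero (ℕₚ.<⇒≤ 2≤i)

  CondA-at-of-CondE : ∀ {i} → 2 ≤ i → CondB-at i → CondE-at i → CondA-at i
  CondA-at-of-CondE 2≤i B E = defect≡0⇒CondA-at (ℕₚ.<⇒≤ 2≤i)
    (trans (defect≡1-floorSum 2≤i B) (x≈y⇒x∙y⁻¹≈ε (sym (cong ℤ→ℚ E))))

  CondE-at-of-CondA : ∀ {i} → 2 ≤ i → CondB-at i → CondA-at i → CondE-at i
  CondE-at-of-CondA 2≤i B A = ℤ→ℚ-injective (sym (x∙y⁻¹≈ε⇒x≈y _ _
    (trans (sym (defect≡1-floorSum 2≤i B)) (CondA-at⇒defect≡0 (ℕₚ.<⇒≤ 2≤i) A))))

  CondE-at-1 : CondE-at 1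
  CondE-at-1 rewrite k₁≡1 | μ1≡1 = refl

  defect-suc : ∀ {i} → 2 ≤ i → k (suc i) < 2 ℕ.* k i → CondA-at i →
               defect (suc i) ≡ (b k i (κ (suc i)) - b k i (κ i)) - ν (suc i)
  defect-suc {i} 2≤i k<2k A = begin
    (1ℚ + b k (suc i) K′) - K′ * (S i + ν (suc i) ÷ℕ k (suc i))
      ≡⟨ cong₂ (λ y z → (1ℚ + y) - z) (b-suc 2≤i K′) (ℚₚ.*-distribˡ-+ K′ (S i) _) ⟩
    (1ℚ + (β′ + c * step k i K′)) - (K′ * S i + K′ * (ν (suc i) ÷ℕ k (suc i)))
      ≡⟨ cong₂ (λ y z → (1ℚ + (β′ + y)) - (K′ * S i + z)) c*step≡K′S-c (ℕ→ℚ*÷ℕ-cancel (k (suc i)) (ν (suc i))) ⟩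
    (1ℚ + (β′ + (K′ * S i - c))) - (K′ * S i + ν (suc i))
      ≡⟨ solve 4 (λ β′ c KS m → (con 1ℚ :+ (β′ :+ (KS :- c))) :- (KS :+ m) := (β′ :- (c :- con 1ℚ)) :- m)
               refl β′ c (K′ * S i) (ν (suc i)) ⟩
    (β′ - (c - 1ℚ)) - ν (suc i)
      ≡⟨ cong (λ y → (β′ - y) - ν (suc i)) (solve 1 (λ β → (con 1ℚ :+ β) :- con 1ℚ := β) refl (b k i (κ i))) ⟩
    (β′ - b k i (κ i)) - ν (suc i)
      ∎
    where
    open ≡-Reasoning
    open ℚ-Solver.+-*-Solver
    instance
      _ = k-nonZero (ℕₚ.<⇒≤ 2≤i)
      _ = k-nonZero {suc i} (s≤s z≤n)
    K = κ i
    K′ = κ (suc i)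
    β′ = b k i K′
    c = 1ℚ + b k i K
    c*step≡K′S-c : c * step k i K′ ≡ K′ * S i - c
    c*step≡K′S-c = begin
      c * step k i K′                 ≡⟨ cong (c *_) (step-at-κ-suc 2≤i k<2k) ⟩
      c * (K′ ÷ℕ k i - 1ℚ)            ≡⟨ cong (λ y → c * (y - 1ℚ)) (÷ℕ-as-* K′ (k i)) ⟩
      c * (K′ * u - 1ℚ)               ≡⟨ solve 3 (λ c K′ u → c :* (K′ :* u :- con 1ℚ) := K′ :* (c :* u) :- c) refl c K′ u ⟩
      K′ * (c * u) - c                ≡⟨ cong (λ y → K′ * y - c) (trans A (÷ℕ-as-* c (k i))) ⟨
      K′ * S i - c                    ∎
      where u = 1ℚ ÷ℕ k i

  CondD-at-of-CondA : ∀ {i} → 2 ≤ i → k (suc i) < 2 ℕ.* k i → CondA-at i → CondA-at (suc i) → CondD-at i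
  CondD-at-of-CondA 2≤i k<2k A A′ = sym (x∙y⁻¹≈ε⇒x≈y _ _
    (trans (sym (defect-suc 2≤i k<2k A)) (CondA-at⇒defect≡0 (s≤s z≤n) A′)))

  CondA-at-suc-of-CondD : ∀ {i} → 2 ≤ i → k (suc i) < 2 ℕ.* k i → CondA-at i → CondD-at i → CondA-at (suc i)
  CondA-at-suc-of-CondD 2≤i k<2k A D = defect≡0⇒CondA-at (s≤s z≤n)
    (trans (defect-suc 2≤i k<2k A) (x≈y⇒x∙y⁻¹≈ε (sym D)))

  CondC-at-suc-of-CondA : ∀ {i} → CondA-at i → CondA-at (suc i) → CondC-at (suc i)
  CondC-at-suc-of-CondA {i} A A′ = begin
    ν (suc i) ÷ℕ k (suc i)              ≡⟨ solve 2 (λ s m → m := (s :+ m) :- s) refl (S i) (ν (suc i) ÷ℕ k (suc i)) ⟩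
    S (suc i) - S i                     ≡⟨ cong₂ _-_ A′ A ⟩
    _                                   ∎
    where
    open ≡-Reasoning
    open ℚ-Solver.+-*-Solver

  CondA-at-suc-of-CondC : ∀ {i} → CondA-at i → CondC-at (suc i) → CondA-at (suc i)
  CondA-at-suc-of-CondC {i} A C = begin
    S i + ν (suc i) ÷ℕ k (suc i)       ≡⟨ cong₂ _+_ A C ⟩
    y + (x - y)                        ≡⟨ solve 2 (λ x y → y :+ (x :- y) := x) refl x y ⟩
    x                                  ∎
    where
    open ≡-Reasoning
    open ℚ-Solver.+-*-Solver
    x = (1ℚ + b k (suc i) (κ (suc i))) ÷ℕ k (suc i)
    y = (1ℚ + b k i (κ i)) ÷ℕ k i

  CondA⇔CondB : CondA k μ ⇔ CondB k μ
  CondA⇔CondB = mk⇔ CondB-of-CondA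
    (λ B i 2≤i → CondA-at-of-CondB 2≤i (B i 2≤i) (B (suc i) (ℕₚ.m≤n⇒m≤1+n 2≤i)))

  CondA⇔CondC : CondA k μ ⇔ CondC k μ
  CondA⇔CondC = mk⇔ to
    (λ C → CondA-by-induction (λ 2≤i A _ → CondA-at-suc-of-CondC A (C _ (s≤s 2≤i))))
    where
    to : CondA k μ → CondC k μ
    to A (suc i) (s≤s 2≤i) = CondC-at-suc-of-CondA (A i 2≤i) (A (suc i) (ℕₚ.m≤n⇒m≤1+n 2≤i))

  CondA⇔CondD : (∀ i → 2 ≤ i → k (suc i) < 2 ℕ.* k i) → CondA k μ ⇔ CondD k μ
  CondA⇔CondD k<2k = mk⇔
    (λ A i 2≤i → CondD-at-of-CondA 2≤i (k<2k i 2≤i) (A i 2≤i) (A (suc i) (ℕₚ.m≤n⇒m≤1+n 2≤i)))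
    (λ D → CondA-by-induction (λ 2≤i A _ → CondA-at-suc-of-CondD 2≤i (k<2k _ 2≤i) A (D _ 2≤i)))

  CondA⇔CondE : CondA k μ ⇔ CondE k μ
  CondA⇔CondE = mk⇔ to
    (λ E → CondA-by-induction
      (λ {i} 2≤i _ B′ → CondA-at-of-CondE (ℕₚ.m≤n⇒m≤1+n 2≤i) B′ (E (suc i) (s≤s z≤n))))
    where
    to : CondA k μ → CondE k μ
    to A (suc zero)    _ = CondE-at-1
    to A (suc (suc i)) _ = CondE-at-of-CondA 2≤i (CondB-of-CondA A (suc (suc i)) 2≤i) (A (suc (suc i)) 2≤i)
      where 2≤i = s≤s (s≤s z≤n)

IsKSeq⇒increasing : ∀ {k} → IsKSeq k → ∀ i → 2 ≤ i → k i < k (suc i)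
IsKSeq⇒increasing {k} (_ , _ , next) i 2≤i with next i 2≤i
... | j , 1≤j , kᵢ₊₁≡kᵢ+j , _ = subst (k i <_) (sym kᵢ₊₁≡kᵢ+j) (m<m+n (k i) 1≤j)

IsMöbius⇒μ2≡-1 : ∀ {μ} → IsMöbius μ → μ 2 ≡ ℤ.- ℤ.1ℤ
IsMöbius⇒μ2≡-1 (_ , μ-of-distinct-primes , _) = μ-of-distinct-primes 2 (2 ∷ []) (from-yes (prime? 2) ∷ []) ([] ∷ []) refl

-- Opened only here: inside the modules above, _*_ is multiplication on ℚ.
open import Data.Nat using (_*_)

lemma3 : (k : ℕ → ℕ) (μ : ℕ → ℤ) → IsMöbius μ → IsKSeq k →
    (CondA k μ ⇔ CondB k μ) × (CondA k μ ⇔ CondC k μ)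
    × ((∀ i → 2 ≤ i → k (suc i) < 2 * k i) →
        (CondA k μ ⇔ CondD k μ) × (CondA k μ ⇔ CondE k μ))
lemma3 k μ isMöbius isKSeq@(k₁≡1 , k₂≡2 , _) =
  CondA⇔CondB , CondA⇔CondC , λ k<2k → CondA⇔CondD k<2k , CondA⇔CondE
  where
  open KSequence k μ k₁≡1 k₂≡2 (IsKSeq⇒increasing isKSeq) (proj₁ isMöbius) (IsMöbius⇒μ2≡-1 isMöbius)
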